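{- Fix $\varepsilon\in(0,1/2)$ and an integer $k\ge2$. There exists a choice of $\alpha=\alpha(\varepsilon,k)>0$ such that for all sufficiently large $N$ (so that $P:=\lfloor\alpha N\rfloor\ge1$), the bipartite graph $U=(L,R;E)$ constructed below is an $(s,\varepsilon)$-PMRS with $n_0=N^{k+2}$ and $s=\Omega(n_0^{k/(k+2)})$. In particular, taking $k=2$ yields $s=\Omega(\sqrt{n_0})$. Construction: write $[N]=\{0,1,\dots,N-1\}$. Let $L$ and $R$ be two disjoint copies of $[N]^k\times[N^2]$, with elements written $(\mathbf x,z)_L$ and $(\mathbf y,t)_R$, so $n_0=|L|=|R|=N^{k+2}$. Let $A:=\{0,1,\dots,P\}^k\setminus\{\mathbf 0\}$ and $s:=|A|=(P+1)^k-1$. For $\mathbf a\in A$ let \[ M_{\mathbf a}:=\bigl\{\bigl((\mathbf x,z)_L,(\mathbf x+\mathbf a,z+\|\mathbf a\|^2)_R\bigr):\ \mathbf x\in[N]^k,\ z\in[N^2],\ \mathbf x+\mathbf a\in[N]^k,\ z+\|\mathbf a\|^2\in[N^2]\bigr\}, \] where $\|\mathbf a\|^2=\sum_i a_i^2$, and let $E:=\bigcup_{\mathbf a\in A}M_{\mathbf a}$. (The PMRS family is $\{M_{\mathbf a}\}_{\mathbf a\in A}$.)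
   Context: A matching $M$ in a graph $\Gamma=(V,E)$ is positive if there is $w:V\to\mathbb{R}$ such that for every edge $\{u,v\}\in E$: $w(u)+w(v)>0$ if and only if $\{u,v\}\in M$. For $\varepsilon\in(0,1/2)$, a bipartite graph $U=(L,R;E)$ with $|L|=|R|=n_0$ is $(s,\varepsilon)$-PMRS if there exist matchings $M_1,\dots,M_s\subseteq E$ that are pairwise edge-disjoint, each of size at least $\varepsilon n_0$, and each positive in $U$.
   Formalization: The parameter ε ranges over the rationals in $(0,1/2)$; the constant α is rational, and the weights w witnessing positivity take values in ℚ rather than ℝ. -}

module Defs where

open import Data.Nat as ℕ using (ℕ; zero; suc; _^_; _∸_)
open import Data.Integer as ℤ using (ℤ; +_)
open import Data.Rational as ℚ using (ℚ; _/_)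
open import Data.Fin using (Fin; toℕ)
open import Data.Vec using (Vec; lookup; foldr; map)
open import Data.List using (List; length)
open import Data.List.Membership.Propositional using (_∈_; _∉_)
open import Data.List.Relation.Unary.All using (All)
open import Data.List.Relation.Unary.AllPairs using (AllPairs)
open import Data.Product using (Σ; ∃; _×_; _,_; proj₁; proj₂)
open import Relation.Binary.PropositionalEquality using (_≡_; _≢_)
open import Function.Bundles using (_⇔_)

-- Generic notions for a bipartite graph (L, R; E), with E a relation
-- between L and R.  An edge {l, r} is represented as the pair (l , r).

ℕ→ℚ : ℕ → ℚ
ℕ→ℚ n = (+ n) / 1

IsMatching : {L R : Set} → (L → R → Set) → List (L × R) → Set
IsMatching E M =
  All (λ e → E (proj₁ e) (proj₂ e)) M ×
  AllPairs (λ e e′ → (proj₁ e ≢ proj₁ e′) × (proj₂ e ≢ proj₂ e′)) M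

-- M is positive in the graph: a weight w : V = L ⊎ R → ℚ (given as its
-- two restrictions) such that for every edge {l,r} of E,
--   w(l) + w(r) > 0  iff  {l,r} ∈ M.
IsPositive : {L R : Set} → (L → R → Set) → List (L × R) → Set
IsPositive {L} {R} E M =
  Σ (L → ℚ) λ wL → Σ (R → ℚ) λ wR →
    ∀ l r → E l r → ((ℚ.0ℚ ℚ.< wL l ℚ.+ wR r) ⇔ ((l , r) ∈ M))

IsPMRS : {L R : Set} → (L → R → Set) → (n₀ s : ℕ) → (ε : ℚ) → Set
IsPMRS E n₀ s ε =
  Σ (Fin s → List (_ × _)) λ M →
    (∀ i → IsMatching E (M i)) ×
    (∀ i j → i ≢ j → ∀ e → e ∈ M i → e ∉ M j) ×
    (∀ i → ε ℚ.* ℕ→ℚ n₀ ℚ.≤ ℕ→ℚ (length (M i))) ×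
    (∀ i → IsPositive E (M i))

Vtx : ℕ → ℕ → Set
Vtx N k = Vec (Fin N) k × Fin (N ^ 2)

normSq : {k : ℕ} → Vec ℕ k → ℕ
normSq a = foldr _ ℕ._+_ 0 (map (λ x → x ℕ.* x) a)

InA : (P k : ℕ) → Vec ℕ k → Set
InA P k a = (∀ i → lookup a i ℕ.≤ P) × (∃ λ i → lookup a i ≢ 0)

InMa : {N k : ℕ} → Vec ℕ k → Vtx N k → Vtx N k → Set
InMa a (x , z) (y , t) =
  (∀ i → toℕ (lookup y i) ≡ toℕ (lookup x i) ℕ.+ lookup a i) ×
  (toℕ t ≡ toℕ z ℕ.+ normSq a)

EdgeU : (N k P : ℕ) → Vtx N k → Vtx N k → Set
EdgeU N k P l r = ∃ λ (a : Vec ℕ k) → InA P k a × InMa a l r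

floorαN : ℚ → ℕ → ℕ
floorαN α N = ℤ.∣ ℚ.floor (α ℚ.* ℕ→ℚ N) ∣

sizeA : ℕ → ℕ → ℕ
sizeA P k = (suc P) ^ k ∸ 1

{-# OPTIONS --safe #-}
-- For a ∈ A the matching M_a is positive, witnessed by the integer weights
--   w((x, z)_L) = z − 2⟨a, x⟩ − ‖a‖² + 1,    w((y, t)_R) = 2⟨a, y⟩ − t :
-- on an edge of M_b we have y = x + b and t = z + ‖b‖², so the two weights sum to
-- 1 − ‖a − b‖², which is positive exactly when b = a. An edge also determines its
-- shift, so the M_a are pairwise disjoint.
--
-- M_a has ∏ᵢ (N − aᵢ) · (N² − ‖a‖²) edges. With α = 1/4k, i.e. P = ⌊N/4k⌋, Bernoulli's
-- inequality gives ∏ᵢ (N − aᵢ) ≥ (N − P)^k ≥ ¾ N^k, and N² − ‖a‖² ≥ N² − kP² ≥ (15/16) N²,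
-- so |M_a| ≥ n₀/2 ≥ ε n₀. The family is indexed by Fin s through the base-(P + 1) digits
-- of i + 1, and s = (P + 1)^k − 1 ≥ P^k ≥ (N/8k)^k.

module Submission where

open import Defs
open import Data.Nat as ℕ using (ℕ; zero; suc; _^_; _+_; _*_; _∸_; _≤_; _<_; z≤n; s≤s; NonZero)
import Data.Nat.Properties as ℕ
open import Data.Nat.DivMod as ℕ using (_/_; _%_)
import Data.Nat.GCD as GCD
import Data.Nat.Coprimality as Coprime
import Data.Nat.Tactic.RingSolver as ℕ
open import Data.Integer as ℤ using (ℤ; +_; -[1+_]; +[1+_]; +≤+; 0ℤ; 1ℤ)
import Data.Integer.Properties as ℤ
import Data.Integer.Tactic.RingSolver as ℤ
open import Data.Rational as ℚ using (ℚ; mkℚ; ↥_; ↧_)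
import Data.Rational.Properties as ℚ
import Data.Rational.Unnormalised as ℚᵘ
import Data.Rational.Unnormalised.Properties as ℚᵘ
open import Data.Fin as Fin using (Fin; toℕ; fromℕ<; inject≤)
import Data.Fin.Properties as Fin
open import Data.Vec as Vec using (Vec; []; _∷_; lookup)
import Data.Vec.Properties as Vec
open import Data.Vec.Relation.Binary.Pointwise.Extensional using (ext; Pointwise-≡⇒≡)
open import Data.List as List using (List; length; tabulate; cartesianProductWith; [_])
import Data.List.Properties as List
open import Data.List.Membership.Propositional using (_∈_)
open import Data.List.Membership.Propositional.Properties
  using (∈-tabulate⁺; ∈-tabulate⁻; ∈-cartesianProductWith⁺; ∈-cartesianProductWith⁻)
open import Data.List.Relation.Unary.Any using (here)
open import Data.List.Relation.Unary.All as All using (All)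
open import Data.List.Relation.Unary.AllPairs as AllPairs using (AllPairs)
open import Data.List.Relation.Unary.Unique.Propositional using (Unique)
import Data.List.Relation.Unary.Unique.Propositional.Properties as Unique
open import Data.Product using (Σ; ∃; _×_; _,_; proj₁; proj₂; uncurry)
open import Data.Sum using (inj₂)
open import Data.Empty using (⊥-elim)
open import Function.Bundles using (_⇔_; mk⇔)
open import Function.Construct.Composition using (_⇔-∘_)
open import Relation.Nullary using (yes; no)
open import Relation.Binary.PropositionalEquality
  using (_≡_; _≢_; refl; cong; cong₂; subst; subst₂; sym; trans; module ≡-Reasoning)

-- Rationals

fromℤ : ℤ → ℚ
fromℤ i = mkℚ i 0 (Coprime.sym (Coprime.1-coprimeTo ℤ.∣ i ∣))

fromℤ-+ : ∀ i j → fromℤ (i ℤ.+ j) ≡ fromℤ i ℚ.+ fromℤ j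
fromℤ-+ i j = ℚ.toℚᵘ-injective (ℚᵘ.≃-sym
  (ℚᵘ.≃-trans (ℚ.toℚᵘ-homo-+ (fromℤ i) (fromℤ j)) (ℚᵘ.*≡* (over-1 i j))))
  where
  over-1 : ∀ i j → (i ℤ.* + 1 ℤ.+ j ℤ.* + 1) ℤ.* + 1 ≡ (i ℤ.+ j) ℤ.* + 1
  over-1 = ℤ.solve-∀

0<fromℤ⇔0<i : ∀ i → (ℚ.0ℚ ℚ.< fromℤ i) ⇔ (0ℤ ℤ.< i)
0<fromℤ⇔0<i i = mk⇔
  (λ { (ℚ.*<* 0<i*1) → subst (0ℤ ℤ.<_) (ℤ.*-identityʳ i) 0<i*1 })
  (λ 0<i → ℚ.*<* (subst (0ℤ ℤ.<_) (sym (ℤ.*-identityʳ i)) 0<i))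

ℕ→ℚ≡fromℤ : ∀ n → ℕ→ℚ n ≡ fromℤ (+ n)
ℕ→ℚ≡fromℤ n = ℚ.normalize-coprime (Coprime.sym (Coprime.1-coprimeTo n))

*ℕ→ℚ≤ℕ→ℚ : ∀ q m n → ↥ q ℤ.* + m ℤ.≤ + n ℤ.* ↧ q → q ℚ.* ℕ→ℚ m ℚ.≤ ℕ→ℚ n
*ℕ→ℚ≤ℕ→ℚ q@(mkℚ _ _ _) m n cross rewrite ℕ→ℚ≡fromℤ m | ℕ→ℚ≡fromℤ n =
  ℚ.toℚᵘ-cancel-≤ (ℚᵘ.≤-respˡ-≃ (ℚᵘ.≃-sym (ℚ.toℚᵘ-homo-* q (fromℤ (+ m))))
    (ℚᵘ.*≤* (subst₂ ℤ._≤_ (over-1ˡ (↥ q) (+ m)) (over-1ʳ (+ n) (↧ q)) cross)))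
  where
  over-1ˡ : ∀ a b → a ℤ.* b ≡ (a ℤ.* b) ℤ.* + 1
  over-1ˡ = ℤ.solve-∀
  over-1ʳ : ∀ a b → a ℤ.* b ≡ a ℤ.* (b ℤ.* + 1)
  over-1ʳ = ℤ.solve-∀

ε*ℕ→ℚ≤ℕ→ℚ : ∀ {ε} → ℚ.0ℚ ℚ.≤ ε → ε ℚ.≤ ℚ.½ →
  ∀ m n → m ≤ 2 * n → ε ℚ.* ℕ→ℚ m ℚ.≤ ℕ→ℚ n
ε*ℕ→ℚ≤ℕ→ℚ {mkℚ -[1+ _ ] _ _} (ℚ.*≤* ()) _ _ _
ε*ℕ→ℚ≤ℕ→ℚ {ε@(mkℚ (+ e) d _)} _ (ℚ.*≤* 2ε≤1) m n m≤2n =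
  *ℕ→ℚ≤ℕ→ℚ ε m n (subst₂ ℤ._≤_ (ℤ.pos-* e m) (ℤ.pos-* n (suc d)) (+≤+ (begin
    e * m              ≤⟨ ℕ.*-monoʳ-≤ e m≤2n ⟩
    e * (2 * n)        ≡⟨ ℕ.*-assoc e 2 n ⟨
    e * 2 * n          ≤⟨ ℕ.*-monoˡ-≤ n e*2≤1+d ⟩
    suc d * n          ≡⟨ ℕ.*-comm (suc d) n ⟩
    n * suc d          ∎)))
  where
  open ℕ.≤-Reasoning
  e*2≤1+d : e * 2 ≤ suc d
  e*2≤1+d = ℤ.drop‿+≤+ (subst₂ ℤ._≤_ (sym (ℤ.pos-* e 2)) (ℤ.*-identityˡ (+ suc d)) 2ε≤1)

1/[1+_] : ℕ → ℚ
1/[1+ d ] = mkℚ (+ 1) d (Coprime.1-coprimeTo (suc d))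

0<1/[1+_] : ∀ d → ℚ.0ℚ ℚ.< 1/[1+ d ]
0<1/[1+ d ] = ℚ.*<* (ℤ.+<+ (s≤s z≤n))

1/[1+d]*ℕ→ℚ≤ℕ→ℚ : ∀ d m n → m ≤ n * suc d → 1/[1+ d ] ℚ.* ℕ→ℚ m ℚ.≤ ℕ→ℚ n
1/[1+d]*ℕ→ℚ≤ℕ→ℚ d m n m≤n[1+d] = *ℕ→ℚ≤ℕ→ℚ 1/[1+ d ] m n
  (subst₂ ℤ._≤_ (sym (ℤ.*-identityˡ (+ m))) (ℤ.pos-* n (suc d)) (+≤+ m≤n[1+d]))

∣floor∣-normalize : ∀ m n .{{_ : NonZero n}} → ℤ.∣ ℚ.floor (ℚ.normalize m n) ∣ ≡ m / n
∣floor∣-normalize m n@(suc _) =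
  trans (∣floor∣-mkℚ+ (m / g) (n / g) (Coprime.coprime-/gcd m n)) m/g/[n/g]≡m/n
  where
  g : ℕ
  g = GCD.gcd m n
  instance
    g≢0 : NonZero g
    g≢0 = ℕ.≢-nonZero (GCD.gcd[m,n]≢0 m n (inj₂ (λ ())))
    n/g≢0 : NonZero (n / g)
    n/g≢0 = ℕ.≢-nonZero (GCD.n/gcd[m,n]≢0 m n)
    n/g*g≢0 : NonZero (n / g * g)
    n/g*g≢0 = ℕ.m*n≢0 (n / g) g
  ∣floor∣-mkℚ+ : ∀ a b .{{_ : NonZero b}} .(c : Coprime.Coprime a b) →
    ℤ.∣ ℚ.floor (ℚ.mkℚ+ a b c) ∣ ≡ a / b
  ∣floor∣-mkℚ+ a (suc b) c = trans (ℤ.abs-◃ _ _) (ℕ.+-identityʳ _)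
  m/g/[n/g]≡m/n : (m / g) / (n / g) ≡ m / n
  m/g/[n/g]≡m/n = begin
    (m / g) / (n / g)          ≡⟨ ℕ.m*n/o*n≡m/o (m / g) g (n / g) ⟨
    (m / g * g) / (n / g * g)  ≡⟨ ℕ./-congˡ (ℕ.m/n*n≡m (GCD.gcd[m,n]∣m m n)) ⟩
    m / (n / g * g)            ≡⟨ ℕ./-congʳ (ℕ.m/n*n≡m (GCD.gcd[m,n]∣n m n)) ⟩
    m / n                      ∎
    where open ≡-Reasoning

floorαN-1/[1+d] : ∀ d N → floorαN 1/[1+ d ] N ≡ N / suc d
floorαN-1/[1+d] d N =
  trans (cong (λ q → ℤ.∣ ℚ.floor q ∣) 1/[1+d]*N≡N/[1+d]) (∣floor∣-normalize N (suc d))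
  where
  1/[1+d]*N≡N/[1+d] : 1/[1+ d ] ℚ.* ℕ→ℚ N ≡ ℚ.normalize N (suc d)
  1/[1+d]*N≡N/[1+d] = trans (cong (1/[1+ d ] ℚ.*_) (ℕ→ℚ≡fromℤ N))
    (ℚ./-cong (ℤ.*-identityˡ (+ N)) (ℕ.*-identityʳ (suc d)))

-- Estimates in ℕ

^-increment-≤ : ∀ n m d → (m + d) ^ suc n ≤ m ^ suc n + suc n * d * (m + d) ^ n
^-increment-≤ zero m d = ℕ.≤-reflexive (identity m d)
  where
  identity : ∀ m d → (m + d) * 1 ≡ m * 1 + 1 * d * 1
  identity = ℕ.solve-∀
^-increment-≤ (suc n) m d = begin
  (m + d) * (m + d) ^ suc n
    ≤⟨ ℕ.*-monoʳ-≤ (m + d) (^-increment-≤ n m d) ⟩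
  (m + d) * (m ^ suc n + suc n * d * (m + d) ^ n)
    ≡⟨ expand m d (m ^ suc n) (suc n) ((m + d) ^ n) ⟩
  m * m ^ suc n + d * m ^ suc n + suc n * d * (m + d) ^ suc n
    ≤⟨ ℕ.+-monoˡ-≤ _ (ℕ.+-monoʳ-≤ (m * m ^ suc n) (ℕ.*-monoʳ-≤ d m^[1+n]≤[m+d]^[1+n])) ⟩
  m * m ^ suc n + d * (m + d) ^ suc n + suc n * d * (m + d) ^ suc n
    ≡⟨ collect (m * m ^ suc n) d ((m + d) ^ suc n) (suc n) ⟩
  m * m ^ suc n + suc (suc n) * d * (m + d) ^ suc n ∎
  where
  open ℕ.≤-Reasoning
  m^[1+n]≤[m+d]^[1+n] : m ^ suc n ≤ (m + d) ^ suc n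
  m^[1+n]≤[m+d]^[1+n] = ℕ.^-monoˡ-≤ (suc n) (ℕ.m≤m+n m d)
  expand : ∀ m d p k q → (m + d) * (p + k * d * q) ≡ m * p + d * p + k * d * ((m + d) * q)
  expand = ℕ.solve-∀
  collect : ∀ x d q k → x + d * q + k * d * q ≡ x + (1 + k) * d * q
  collect = ℕ.solve-∀

3*m^k≤4*[m∸n]^k : ∀ k {m n} → 4 * k * n ≤ m → 3 * m ^ k ≤ 4 * (m ∸ n) ^ k
3*m^k≤4*[m∸n]^k zero    _      = s≤s (s≤s (s≤s z≤n))
3*m^k≤4*[m∸n]^k (suc j) {m} {n} 4kn≤m = ℕ.+-cancelʳ-≤ (m ^ k) _ _ (begin
  3 * m ^ k + m ^ k                      ≡⟨ 3x+x≡4x (m ^ k) ⟩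
  4 * m ^ k                              ≤⟨ ℕ.*-monoʳ-≤ 4 bernoulli ⟩
  4 * ((m ∸ n) ^ k + k * n * m ^ j)      ≡⟨ ℕ.*-distribˡ-+ 4 ((m ∸ n) ^ k) _ ⟩
  4 * (m ∸ n) ^ k + 4 * (k * n * m ^ j)  ≤⟨ ℕ.+-monoʳ-≤ (4 * (m ∸ n) ^ k) increment≤m^k ⟩
  4 * (m ∸ n) ^ k + m ^ k                ∎)
  where
  open ℕ.≤-Reasoning
  k : ℕ
  k = suc j
  3x+x≡4x : ∀ x → 3 * x + x ≡ 4 * x
  3x+x≡4x = ℕ.solve-∀
  n≤m : n ≤ m
  n≤m = ℕ.≤-trans (ℕ.m≤n*m n (4 * k)) 4kn≤m
  bernoulli : m ^ k ≤ (m ∸ n) ^ k + k * n * m ^ j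
  bernoulli = subst (λ m′ → m′ ^ k ≤ (m ∸ n) ^ k + k * n * m′ ^ j) (ℕ.m∸n+n≡m n≤m)
    (^-increment-≤ j (m ∸ n) n)
  increment≤m^k : 4 * (k * n * m ^ j) ≤ m ^ k
  increment≤m^k = subst (_≤ m ^ k) (reassociate 4 k n (m ^ j)) (ℕ.*-monoˡ-≤ (m ^ j) 4kn≤m)
    where
    reassociate : ∀ a b c d → a * b * c * d ≡ a * (b * c * d)
    reassociate = ℕ.solve-∀

15*m≤16*[m∸n] : ∀ {m n} → 16 * n ≤ m → 15 * m ≤ 16 * (m ∸ n)
15*m≤16*[m∸n] {m} {n} 16n≤m = begin
  15 * m               ≡⟨ ℕ.m+n∸n≡m (15 * m) m ⟨
  15 * m + m ∸ m       ≤⟨ ℕ.∸-monoʳ-≤ (15 * m + m) 16n≤m ⟩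
  15 * m + m ∸ 16 * n  ≡⟨ cong (_∸ 16 * n) (15x+x≡16x m) ⟩
  16 * m ∸ 16 * n      ≡⟨ ℕ.*-distribˡ-∸ 16 m n ⟨
  16 * (m ∸ n)         ∎
  where
  open ℕ.≤-Reasoning
  15x+x≡16x : ∀ x → 15 * x + x ≡ 16 * x
  15x+x≡16x = ℕ.solve-∀

[m*n]^k≡m^k*n^k : ∀ m n k → (m * n) ^ k ≡ m ^ k * n ^ k
[m*n]^k≡m^k*n^k m n zero    = refl
[m*n]^k≡m^k*n^k m n (suc k) =
  trans (cong (m * n *_) ([m*n]^k≡m^k*n^k m n k)) (interchange m n (m ^ k) (n ^ k))
  where
  interchange : ∀ a b c d → a * b * (c * d) ≡ a * c * (b * d)
  interchange = ℕ.solve-∀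

n≤2*m*[n/m] : ∀ n m .{{_ : NonZero m}} → m ≤ n → n ≤ 2 * m * (n / m)
n≤2*m*[n/m] n m m≤n = begin
  n                       ≡⟨ ℕ.m≡m%n+[m/n]*n n m ⟩
  n % m + n / m * m       ≤⟨ ℕ.+-monoˡ-≤ (n / m * m) (ℕ.<⇒≤ (ℕ.m%n<n n m)) ⟩
  m + n / m * m           ≤⟨ ℕ.+-monoˡ-≤ (n / m * m) (ℕ.m≤n*m m (n / m) {{n/m≢0}}) ⟩
  n / m * m + n / m * m   ≡⟨ double (n / m) m ⟩
  2 * m * (n / m)         ∎
  where
  open ℕ.≤-Reasoning
  n/m≢0 : NonZero (n / m)
  n/m≢0 = ℕ.>-nonZero (ℕ.m≥n⇒m/n>0 m≤n)
  double : ∀ q m → q * m + q * m ≡ 2 * m * q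
  double = ℕ.solve-∀

n^k≤sizeA : ∀ n k .{{_ : NonZero k}} → n ^ k ≤ sizeA n k
n^k≤sizeA n k = ℕ.m+n≤o⇒m≤o∸n (n ^ k)
  (subst (_≤ suc n ^ k) (ℕ.+-comm 1 (n ^ k)) (ℕ.^-monoˡ-< k (ℕ.n<1+n n)))

N^k≤sizeA*[1+m^k] : ∀ N m P k .{{_ : NonZero k}} → N ≤ m * P → N ^ k ≤ sizeA P k * suc (m ^ k)
N^k≤sizeA*[1+m^k] N m P k N≤mP = begin
  N ^ k                        ≤⟨ ℕ.^-monoˡ-≤ k N≤mP ⟩
  (m * P) ^ k                  ≡⟨ [m*n]^k≡m^k*n^k m P k ⟩
  m ^ k * P ^ k                ≤⟨ ℕ.*-monoʳ-≤ (m ^ k) (n^k≤sizeA P k) ⟩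
  m ^ k * sizeA P k            ≤⟨ ℕ.m≤n+m (m ^ k * sizeA P k) (sizeA P k) ⟩
  suc (m ^ k) * sizeA P k      ≡⟨ ℕ.*-comm (suc (m ^ k)) (sizeA P k) ⟩
  sizeA P k * suc (m ^ k)      ∎
  where open ℕ.≤-Reasoning

-- The matchings M_a as duplicate-free lists

length-cartesianProductWith : ∀ {A B C : Set} (f : A → B → C) xs ys →
  length (cartesianProductWith f xs ys) ≡ length xs * length ys
length-cartesianProductWith f List.[]       ys = refl
length-cartesianProductWith f (x List.∷ xs) ys = begin
  length (List.map (f x) ys List.++ cartesianProductWith f xs ys)
    ≡⟨ List.length-++ (List.map (f x) ys) ⟩
  length (List.map (f x) ys) + length (cartesianProductWith f xs ys)
    ≡⟨ cong₂ _+_ (List.length-map (f x) ys) (length-cartesianProductWith f xs ys) ⟩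
  length ys + length xs * length ys ∎
  where open ≡-Reasoning

product : ∀ {k} → Vec ℕ k → ℕ
product = Vec.foldr _ _*_ 1

Shift : ∀ {m} → ℕ → Fin m → Fin m → Set
Shift n u v = toℕ v ≡ toℕ u + n

toℕ+n<m : ∀ m n (j : Fin (m ∸ n)) → toℕ j + n < m
toℕ+n<m m n j = ℕ.m≤o∸n⇒m+n≤o (suc (toℕ j)) n≤m (Fin.toℕ<n j)
  where
  n≤m : n ≤ m
  n≤m = ℕ.<⇒≤ (ℕ.m∸n≢0⇒n<m (λ m∸n≡0 → Fin.¬Fin0 (subst Fin m∸n≡0 j)))

shiftPair : ∀ m n → Fin (m ∸ n) → Fin m × Fin m
shiftPair m n j = inject≤ j (ℕ.m∸n≤m m n) , fromℕ< (toℕ+n<m m n j)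

shiftPairs : ∀ m n → List (Fin m × Fin m)
shiftPairs m n = tabulate (shiftPair m n)

∈-shiftPairs⁻ : ∀ {m n u v} → (u , v) ∈ shiftPairs m n → Shift n u v
∈-shiftPairs⁻ {m} {n} uv∈ with ∈-tabulate⁻ uv∈
... | j , refl = begin
  toℕ (fromℕ< (toℕ+n<m m n j))       ≡⟨ Fin.toℕ-fromℕ< _ ⟩
  toℕ j + n                           ≡⟨ cong (_+ n) (Fin.toℕ-inject≤ j _) ⟨
  toℕ (inject≤ j (ℕ.m∸n≤m m n)) + n ∎
  where open ≡-Reasoning

∈-shiftPairs⁺ : ∀ {m n u v} → Shift n u v → (u , v) ∈ shiftPairs m n
∈-shiftPairs⁺ {m} {n} {u} {v} v≡u+n = subst (_∈ shiftPairs m n) shiftPair-j≡uv (∈-tabulate⁺ j)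
  where
  u<m∸n : toℕ u < m ∸ n
  u<m∸n = ℕ.m+n≤o⇒m≤o∸n (suc (toℕ u)) (subst (_< m) v≡u+n (Fin.toℕ<n v))
  j : Fin (m ∸ n)
  j = fromℕ< u<m∸n
  shiftPair-j≡uv : shiftPair m n j ≡ (u , v)
  shiftPair-j≡uv = cong₂ _,_
    (Fin.toℕ-injective (trans (Fin.toℕ-inject≤ j _) (Fin.toℕ-fromℕ< u<m∸n)))
    (Fin.toℕ-injective (trans (Fin.toℕ-fromℕ< _)
      (trans (cong (_+ n) (Fin.toℕ-fromℕ< u<m∸n)) (sym v≡u+n))))

shiftPairs-unique : ∀ m n → Unique (shiftPairs m n)
shiftPairs-unique m n = Unique.tabulate⁺ (λ {i} {j} eq → Fin.inject≤-injective _ _ i j (cong proj₁ eq))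

length-shiftPairs : ∀ m n → length (shiftPairs m n) ≡ m ∸ n
length-shiftPairs m n = List.length-tabulate (shiftPair m n)

ShiftVec : ∀ {k m} → Vec ℕ k → Vec (Fin m) k → Vec (Fin m) k → Set
ShiftVec a x y = ∀ i → Shift (lookup a i) (lookup x i) (lookup y i)

consPair : ∀ {A : Set} {k} → A × A → Vec A k × Vec A k → Vec A (suc k) × Vec A (suc k)
consPair (u , v) (x , y) = u ∷ x , v ∷ y

consPair-injective : ∀ {A : Set} {k} {p q : A × A} {r s : Vec A k × Vec A k} →
  consPair p r ≡ consPair q s → p ≡ q × r ≡ s
consPair-injective {p = _ , _} {_ , _} {_ , _} {_ , _} refl = refl , refl

shiftVecPairs : ∀ {k} m → Vec ℕ k → List (Vec (Fin m) k × Vec (Fin m) k)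
shiftVecPairs m []      = [ [] , [] ]
shiftVecPairs m (n ∷ a) = cartesianProductWith consPair (shiftPairs m n) (shiftVecPairs m a)

∈-shiftVecPairs⁻ : ∀ {k m} (a : Vec ℕ k) {x y} → (x , y) ∈ shiftVecPairs m a → ShiftVec a x y
∈-shiftVecPairs⁻ {m = m} (n ∷ a) xy∈
  with ∈-cartesianProductWith⁻ consPair (shiftPairs m n) (shiftVecPairs m a) xy∈
... | _ , _ , uv∈ , xy∈′ , refl = λ where
  Fin.zero    → ∈-shiftPairs⁻ uv∈
  (Fin.suc i) → ∈-shiftVecPairs⁻ a xy∈′ i

∈-shiftVecPairs⁺ : ∀ {k m} (a : Vec ℕ k) {x y} → ShiftVec a x y → (x , y) ∈ shiftVecPairs m a
∈-shiftVecPairs⁺ []      {[]}    {[]}    _   = here refl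
∈-shiftVecPairs⁺ (n ∷ a) {_ ∷ _} {_ ∷ _} x↦y =
  ∈-cartesianProductWith⁺ consPair (∈-shiftPairs⁺ (x↦y Fin.zero)) (∈-shiftVecPairs⁺ a (λ i → x↦y (Fin.suc i)))

shiftVecPairs-unique : ∀ {k} m (a : Vec ℕ k) → Unique (shiftVecPairs m a)
shiftVecPairs-unique m []      = All.[] AllPairs.∷ AllPairs.[]
shiftVecPairs-unique m (n ∷ a) =
  Unique.cartesianProductWith⁺ consPair consPair-injective (shiftPairs-unique m n) (shiftVecPairs-unique m a)

length-shiftVecPairs : ∀ {k} m (a : Vec ℕ k) → length (shiftVecPairs m a) ≡ product (Vec.map (m ∸_) a)
length-shiftVecPairs m []      = refl
length-shiftVecPairs m (n ∷ a) = trans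
  (length-cartesianProductWith consPair (shiftPairs m n) (shiftVecPairs m a))
  (cong₂ _*_ (length-shiftPairs m n) (length-shiftVecPairs m a))

edge : ∀ {N k} → Vec (Fin N) k × Vec (Fin N) k → Fin (N ^ 2) × Fin (N ^ 2) → Vtx N k × Vtx N k
edge (x , y) (z , t) = (x , z) , (y , t)

edge-injective : ∀ {N k} {p q} {r s} → edge {N} {k} p r ≡ edge q s → p ≡ q × r ≡ s
edge-injective {p = _ , _} {_ , _} {_ , _} {_ , _} refl = refl , refl

Ma : ∀ {k} N → Vec ℕ k → List (Vtx N k × Vtx N k)
Ma N a = cartesianProductWith edge (shiftVecPairs N a) (shiftPairs (N ^ 2) (normSq a))

∈-Ma⁻ : ∀ {k N} (a : Vec ℕ k) {e} → e ∈ Ma N a → uncurry (InMa a) e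
∈-Ma⁻ {N = N} a e∈ with ∈-cartesianProductWith⁻ edge (shiftVecPairs N a) (shiftPairs (N ^ 2) (normSq a)) e∈
... | _ , _ , xy∈ , zt∈ , refl = ∈-shiftVecPairs⁻ a xy∈ , ∈-shiftPairs⁻ zt∈

∈-Ma⁺ : ∀ {k N} (a : Vec ℕ k) {l r} → InMa a l r → (l , r) ∈ Ma N a
∈-Ma⁺ a (x↦y , z↦t) = ∈-cartesianProductWith⁺ edge (∈-shiftVecPairs⁺ a x↦y) (∈-shiftPairs⁺ z↦t)

Ma-unique : ∀ {k} N (a : Vec ℕ k) → Unique (Ma N a)
Ma-unique N a =
  Unique.cartesianProductWith⁺ edge edge-injective (shiftVecPairs-unique N a) (shiftPairs-unique (N ^ 2) (normSq a))

length-Ma : ∀ {k} N (a : Vec ℕ k) → length (Ma N a) ≡ product (Vec.map (N ∸_) a) * (N ^ 2 ∸ normSq a)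
length-Ma N a = trans
  (length-cartesianProductWith edge (shiftVecPairs N a) _)
  (cong₂ _*_ (length-shiftVecPairs N a) (length-shiftPairs (N ^ 2) (normSq a)))

-- Each M_a is a matching

DisjointEndpoints : {L R : Set} → L × R → L × R → Set
DisjointEndpoints e e′ = (proj₁ e ≢ proj₁ e′) × (proj₂ e ≢ proj₂ e′)

module _ {L R : Set} {S : L → R → Set}
         (functional : ∀ {l r r′} → S l r → S l r′ → r ≡ r′)
         (injective  : ∀ {l l′ r} → S l r → S l′ r → l ≡ l′) where

  Unique⇒AllPairs-DisjointEndpoints : ∀ {M} → All (uncurry S) M → Unique M →
    AllPairs DisjointEndpoints M
  Unique⇒AllPairs-DisjointEndpoints All.[]         AllPairs.[]        = AllPairs.[]
  Unique⇒AllPairs-DisjointEndpoints (s All.∷ ss) (e∉ AllPairs.∷ es) =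
    All.zipWith (λ (s′ , e≢e′) → disjoint s s′ e≢e′) (ss , e∉) AllPairs.∷
    Unique⇒AllPairs-DisjointEndpoints ss es
    where
    disjoint : ∀ {l r l′ r′} → S l r → S l′ r′ → (l , r) ≢ (l′ , r′) →
      DisjointEndpoints (l , r) (l′ , r′)
    disjoint {l} {r} s s′ e≢e′ =
      (λ { refl → e≢e′ (cong (l ,_) (functional s s′)) }) ,
      (λ { refl → e≢e′ (cong (_, r) (injective s s′)) })

module _ {N k : ℕ} (a : Vec ℕ k) where

  InMa-functional : ∀ {l r r′} → InMa {N} a l r → InMa a l r′ → r ≡ r′
  InMa-functional {r = _ , _} {_ , _} (x↦y , z↦t) (x↦y′ , z↦t′) = cong₂ _,_
    (Pointwise-≡⇒≡ (ext λ i → Fin.toℕ-injective (trans (x↦y i) (sym (x↦y′ i)))))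
    (Fin.toℕ-injective (trans z↦t (sym z↦t′)))

  InMa-injective : ∀ {l l′ r} → InMa {N} a l r → InMa a l′ r → l ≡ l′
  InMa-injective {_ , _} {_ , _} (x↦y , z↦t) (x′↦y , z′↦t) = cong₂ _,_
    (Pointwise-≡⇒≡ (ext λ i → Fin.toℕ-injective (ℕ.+-cancelʳ-≡ _ _ _ (trans (sym (x↦y i)) (x′↦y i)))))
    (Fin.toℕ-injective (ℕ.+-cancelʳ-≡ _ _ _ (trans (sym z↦t) z′↦t)))

InMa-determines-shift : ∀ {N k} {a b : Vec ℕ k} {l r} → InMa {N} a l r → InMa b l r → a ≡ b
InMa-determines-shift {l = x , _} (x↦y , _) (x↦y′ , _) =
  Pointwise-≡⇒≡ (ext λ i → ℕ.+-cancelˡ-≡ (toℕ (lookup x i)) _ _ (trans (sym (x↦y i)) (x↦y′ i)))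

Ma-isMatching : ∀ {N k P} {a : Vec ℕ k} → InA P k a → IsMatching (EdgeU N k P) (Ma N a)
Ma-isMatching {a = a} a∈A =
  All.tabulate (λ e∈ → a , a∈A , ∈-Ma⁻ a e∈) ,
  Unique⇒AllPairs-DisjointEndpoints
    (λ {l r r′} → InMa-functional a {l} {r} {r′}) (λ {l l′ r} → InMa-injective a {l} {l′} {r})
    (All.tabulate (∈-Ma⁻ a)) (Ma-unique _ a)

-- Each M_a is positive

0≤i*i : ∀ i → 0ℤ ℤ.≤ i ℤ.* i
0≤i*i (+ zero)   = +≤+ z≤n
0≤i*i +[1+ n ]   = +≤+ z≤n
0≤i*i -[1+ n ]   = +≤+ z≤n

1≤i*i : ∀ i → i ≢ 0ℤ → 1ℤ ℤ.≤ i ℤ.* i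
1≤i*i (+ zero)   i≢0 = ⊥-elim (i≢0 refl)
1≤i*i +[1+ n ]   _   = +≤+ (s≤s z≤n)
1≤i*i -[1+ n ]   _   = +≤+ (s≤s z≤n)

⟨_,_⟩ : ∀ {k} → Vec ℕ k → Vec ℕ k → ℤ
⟨ []    , []    ⟩ = 0ℤ
⟨ m ∷ a , n ∷ b ⟩ = + m ℤ.* + n ℤ.+ ⟨ a , b ⟩

∥_-_∥² : ∀ {k} → Vec ℕ k → Vec ℕ k → ℤ
∥ []    - []    ∥² = 0ℤ
∥ m ∷ a - n ∷ b ∥² = (+ m ℤ.- + n) ℤ.* (+ m ℤ.- + n) ℤ.+ ∥ a - b ∥²

⟨⟩-shift : ∀ {k N} (a b : Vec ℕ k) {x y : Vec (Fin N) k} → ShiftVec b x y →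
  ⟨ a , Vec.map toℕ y ⟩ ≡ ⟨ a , Vec.map toℕ x ⟩ ℤ.+ ⟨ a , b ⟩
⟨⟩-shift []      []      {[]}    {[]}    _   = refl
⟨⟩-shift (m ∷ a) (n ∷ b) {u ∷ x} {v ∷ y} x↦y = begin
  + m ℤ.* + toℕ v ℤ.+ ⟨ a , Vec.map toℕ y ⟩
    ≡⟨ cong₂ (λ v′ s → + m ℤ.* v′ ℤ.+ s) (cong +_ (x↦y Fin.zero)) (⟨⟩-shift a b (λ i → x↦y (Fin.suc i))) ⟩
  + m ℤ.* + (toℕ u + n) ℤ.+ (⟨ a , Vec.map toℕ x ⟩ ℤ.+ ⟨ a , b ⟩)
    ≡⟨ cong (λ w → + m ℤ.* w ℤ.+ (⟨ a , Vec.map toℕ x ⟩ ℤ.+ ⟨ a , b ⟩)) (ℤ.pos-+ (toℕ u) n) ⟩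
  + m ℤ.* (+ toℕ u ℤ.+ + n) ℤ.+ (⟨ a , Vec.map toℕ x ⟩ ℤ.+ ⟨ a , b ⟩)
    ≡⟨ distribute (+ m) (+ toℕ u) (+ n) _ _ ⟩
  (+ m ℤ.* + toℕ u ℤ.+ ⟨ a , Vec.map toℕ x ⟩) ℤ.+ (+ m ℤ.* + n ℤ.+ ⟨ a , b ⟩) ∎
  where
  open ≡-Reasoning
  distribute : ∀ m u n s t → m ℤ.* (u ℤ.+ n) ℤ.+ (s ℤ.+ t) ≡ (m ℤ.* u ℤ.+ s) ℤ.+ (m ℤ.* n ℤ.+ t)
  distribute = ℤ.solve-∀

+normSq : ∀ {k} (a : Vec ℕ k) → + normSq a ≡ ⟨ a , a ⟩
+normSq []      = refl
+normSq (m ∷ a) = begin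
  + (m * m + normSq a)         ≡⟨ ℤ.pos-+ (m * m) (normSq a) ⟩
  + (m * m) ℤ.+ + normSq a     ≡⟨ cong₂ ℤ._+_ (ℤ.pos-* m m) (+normSq a) ⟩
  + m ℤ.* + m ℤ.+ ⟨ a , a ⟩    ∎
  where open ≡-Reasoning

⟨⟩-polarization : ∀ {k} (a b : Vec ℕ k) → ⟨ a , a ⟩ ℤ.- + 2 ℤ.* ⟨ a , b ⟩ ℤ.+ ⟨ b , b ⟩ ≡ ∥ a - b ∥²
⟨⟩-polarization []      []      = refl
⟨⟩-polarization (m ∷ a) (n ∷ b) = trans
  (expand (+ m) (+ n) ⟨ a , a ⟩ ⟨ a , b ⟩ ⟨ b , b ⟩)
  (cong (λ s → (+ m ℤ.- + n) ℤ.* (+ m ℤ.- + n) ℤ.+ s) (⟨⟩-polarization a b))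
  where
  expand : ∀ m n aa ab bb →
    (m ℤ.* m ℤ.+ aa) ℤ.- + 2 ℤ.* (m ℤ.* n ℤ.+ ab) ℤ.+ (n ℤ.* n ℤ.+ bb) ≡
    (m ℤ.- n) ℤ.* (m ℤ.- n) ℤ.+ (aa ℤ.- + 2 ℤ.* ab ℤ.+ bb)
  expand = ℤ.solve-∀

∥a-a∥²≡0 : ∀ {k} (a : Vec ℕ k) → ∥ a - a ∥² ≡ 0ℤ
∥a-a∥²≡0 []      = refl
∥a-a∥²≡0 (m ∷ a) rewrite ℤ.+-inverseʳ (+ m) = trans (ℤ.+-identityˡ _) (∥a-a∥²≡0 a)

0≤∥a-b∥² : ∀ {k} (a b : Vec ℕ k) → 0ℤ ℤ.≤ ∥ a - b ∥²
0≤∥a-b∥² []      []      = ℤ.≤-refl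
0≤∥a-b∥² (m ∷ a) (n ∷ b) = ℤ.+-mono-≤ (0≤i*i (+ m ℤ.- + n)) (0≤∥a-b∥² a b)

1≤∥a-b∥² : ∀ {k} (a b : Vec ℕ k) → a ≢ b → 1ℤ ℤ.≤ ∥ a - b ∥²
1≤∥a-b∥² []      []      a≢b = ⊥-elim (a≢b refl)
1≤∥a-b∥² (m ∷ a) (n ∷ b) a≢b with m ℕ.≟ n
... | yes refl = ℤ.+-mono-≤ (0≤i*i (+ m ℤ.- + m)) (1≤∥a-b∥² a b (λ a≡b → a≢b (cong (m ∷_) a≡b)))
... | no m≢n   = ℤ.+-mono-≤ (1≤i*i (+ m ℤ.- + n) m-n≢0) (0≤∥a-b∥² a b)
  where
  m-n≢0 : + m ℤ.- + n ≢ 0ℤ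
  m-n≢0 m-n≡0 = m≢n (ℤ.+-injective (ℤ.i-j≡0⇒i≡j (+ m) (+ n) m-n≡0))

0<1-∥a-b∥²⇔a≡b : ∀ {k} (a b : Vec ℕ k) → (0ℤ ℤ.< 1ℤ ℤ.- ∥ a - b ∥²) ⇔ (a ≡ b)
0<1-∥a-b∥²⇔a≡b a b = mk⇔ to from
  where
  to : 0ℤ ℤ.< 1ℤ ℤ.- ∥ a - b ∥² → a ≡ b
  to 0<1-∥a-b∥² with Vec.≡-dec ℕ._≟_ a b
  ... | yes a≡b = a≡b
  ... | no  a≢b = ⊥-elim (ℤ.<⇒≱ 0<1-∥a-b∥² (ℤ.i≤j⇒i-j≤0 (1≤∥a-b∥² a b a≢b)))
  from : a ≡ b → 0ℤ ℤ.< 1ℤ ℤ.- ∥ a - b ∥²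
  from refl rewrite ∥a-a∥²≡0 a = ℤ.+<+ (s≤s z≤n)

weightL : ∀ {N k} → Vec ℕ k → Vtx N k → ℤ
weightL a (x , z) = + toℕ z ℤ.- + 2 ℤ.* ⟨ a , Vec.map toℕ x ⟩ ℤ.- ⟨ a , a ⟩ ℤ.+ 1ℤ

weightR : ∀ {N k} → Vec ℕ k → Vtx N k → ℤ
weightR a (y , t) = + 2 ℤ.* ⟨ a , Vec.map toℕ y ⟩ ℤ.- + toℕ t

weight-on-Ma : ∀ {N k} (a b : Vec ℕ k) {l r : Vtx N k} → InMa b l r →
  weightL a l ℤ.+ weightR a r ≡ 1ℤ ℤ.- ∥ a - b ∥²
weight-on-Ma a b {x , z} {y , t} (x↦y , z↦t) = begin
  weightL a (x , z) ℤ.+ (+ 2 ℤ.* ⟨ a , Vec.map toℕ y ⟩ ℤ.- + toℕ t)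
    ≡⟨ cong₂ (λ ay t′ → weightL a (x , z) ℤ.+ (+ 2 ℤ.* ay ℤ.- t′)) (⟨⟩-shift a b x↦y) +t≡+z+⟨b,b⟩ ⟩
  weightL a (x , z) ℤ.+ (+ 2 ℤ.* (⟨ a , Vec.map toℕ x ⟩ ℤ.+ ⟨ a , b ⟩) ℤ.- (+ toℕ z ℤ.+ ⟨ b , b ⟩))
    ≡⟨ cancel (+ toℕ z) ⟨ a , Vec.map toℕ x ⟩ ⟨ a , a ⟩ ⟨ a , b ⟩ ⟨ b , b ⟩ ⟩
  1ℤ ℤ.- (⟨ a , a ⟩ ℤ.- + 2 ℤ.* ⟨ a , b ⟩ ℤ.+ ⟨ b , b ⟩)
    ≡⟨ cong (ℤ._-_ 1ℤ) (⟨⟩-polarization a b) ⟩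
  1ℤ ℤ.- ∥ a - b ∥² ∎
  where
  open ≡-Reasoning
  +t≡+z+⟨b,b⟩ : + toℕ t ≡ + toℕ z ℤ.+ ⟨ b , b ⟩
  +t≡+z+⟨b,b⟩ = trans (cong +_ z↦t) (trans (ℤ.pos-+ (toℕ z) (normSq b)) (cong (ℤ._+_ (+ toℕ z)) (+normSq b)))
  cancel : ∀ z ax aa ab bb →
    (z ℤ.- + 2 ℤ.* ax ℤ.- aa ℤ.+ 1ℤ) ℤ.+ (+ 2 ℤ.* (ax ℤ.+ ab) ℤ.- (z ℤ.+ bb)) ≡
    1ℤ ℤ.- (aa ℤ.- + 2 ℤ.* ab ℤ.+ bb)
  cancel = ℤ.solve-∀

integerWeights⇒IsPositive : ∀ {L R : Set} {E : L → R → Set} {M : List (L × R)}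
  (wL : L → ℤ) (wR : R → ℤ) →
  (∀ l r → E l r → (0ℤ ℤ.< wL l ℤ.+ wR r) ⇔ ((l , r) ∈ M)) → IsPositive E M
integerWeights⇒IsPositive wL wR sign-test =
  (λ l → fromℤ (wL l)) , (λ r → fromℤ (wR r)) , λ l r e →
    subst (λ q → (ℚ.0ℚ ℚ.< q) ⇔ _) (fromℤ-+ (wL l) (wR r))
      (sign-test l r e ⇔-∘ 0<fromℤ⇔0<i (wL l ℤ.+ wR r))

Ma-isPositive : ∀ {N k} P (a : Vec ℕ k) → IsPositive (EdgeU N k P) (Ma N a)
Ma-isPositive {N} {k} P a = integerWeights⇒IsPositive (weightL a) (weightR a) sign-test
  where
  sign-test : ∀ l r → EdgeU N k P l r → (0ℤ ℤ.< weightL a l ℤ.+ weightR a r) ⇔ ((l , r) ∈ Ma N a)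
  sign-test l r (b , _ , l↦r) =
    subst (λ w → (0ℤ ℤ.< w) ⇔ ((l , r) ∈ Ma N a)) (sym (weight-on-Ma a b l↦r))
      (a≡b⇔lr∈Ma ⇔-∘ 0<1-∥a-b∥²⇔a≡b a b)
    where
    a≡b⇔lr∈Ma : (a ≡ b) ⇔ ((l , r) ∈ Ma N a)
    a≡b⇔lr∈Ma = mk⇔ (λ { refl → ∈-Ma⁺ a l↦r })
      (λ lr∈Ma → InMa-determines-shift {l = l} {r} (∈-Ma⁻ a lr∈Ma) l↦r)

-- Each M_a is large

BoundedBy : ℕ → ∀ {k} → Vec ℕ k → Set
BoundedBy P a = ∀ i → lookup a i ≤ P

[m∸n]^k≤product : ∀ {k} m {n} (a : Vec ℕ k) → BoundedBy n a → (m ∸ n) ^ k ≤ product (Vec.map (m ∸_) a)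
[m∸n]^k≤product m []      _   = ℕ.≤-refl
[m∸n]^k≤product m (c ∷ a) a≤n =
  ℕ.*-mono-≤ (ℕ.∸-monoʳ-≤ m (a≤n Fin.zero)) ([m∸n]^k≤product m a (λ i → a≤n (Fin.suc i)))

normSq≤k*n*n : ∀ {k n} (a : Vec ℕ k) → BoundedBy n a → normSq a ≤ k * (n * n)
normSq≤k*n*n []      _   = z≤n
normSq≤k*n*n (c ∷ a) a≤n =
  ℕ.+-mono-≤ (ℕ.*-mono-≤ (a≤n Fin.zero) (a≤n Fin.zero)) (normSq≤k*n*n a (λ i → a≤n (Fin.suc i)))

16*normSq≤m^2 : ∀ {k m n} (a : Vec ℕ k) → BoundedBy n a → 4 * k * n ≤ m → 16 * normSq a ≤ m ^ 2
16*normSq≤m^2 {k} {m} {n} a a≤n 4kn≤m = begin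
  16 * normSq a             ≤⟨ ℕ.*-monoʳ-≤ 16 (normSq≤k*n*n a a≤n) ⟩
  16 * (k * (n * n))        ≤⟨ ℕ.*-monoʳ-≤ 16 (ℕ.*-monoˡ-≤ (n * n) (k≤k*k k)) ⟩
  16 * (k * k * (n * n))    ≡⟨ regroup k n ⟩
  (4 * k * n) ^ 2           ≤⟨ ℕ.^-monoˡ-≤ 2 4kn≤m ⟩
  m ^ 2                     ∎
  where
  open ℕ.≤-Reasoning
  regroup : ∀ k n → 16 * (k * k * (n * n)) ≡ (4 * k * n) * ((4 * k * n) * 1)
  regroup = ℕ.solve-∀
  k≤k*k : ∀ k → k ≤ k * k
  k≤k*k zero    = z≤n
  k≤k*k (suc k) = ℕ.m≤m*n (suc k) (suc k)

Ma-large : ∀ {k N P} (a : Vec ℕ k) → BoundedBy P a → 4 * k * P ≤ N →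
  N ^ (k + 2) ≤ 2 * length (Ma N a)
Ma-large {k} {N} {P} a a≤P 4kP≤N rewrite length-Ma N a = ℕ.*-cancelˡ-≤ 32 (begin
  32 * N ^ (k + 2)                        ≡⟨ cong (32 *_) (ℕ.^-distribˡ-+-* N k 2) ⟩
  32 * (N ^ k * N ^ 2)                    ≤⟨ ℕ.*-monoˡ-≤ (N ^ k * N ^ 2) (ℕ.m≤m+n 32 13) ⟩
  45 * (N ^ k * N ^ 2)                    ≡⟨ split-45 (N ^ k) (N ^ 2) ⟩
  (3 * N ^ k) * (15 * N ^ 2)              ≤⟨ ℕ.*-mono-≤ (3*m^k≤4*[m∸n]^k k 4kP≤N) 15*N^2≤16*Δ ⟩
  (4 * (N ∸ P) ^ k) * (16 * Δ)            ≤⟨ ℕ.*-monoˡ-≤ (16 * Δ) (ℕ.*-monoʳ-≤ 4 ([m∸n]^k≤product N a a≤P)) ⟩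
  (4 * Π) * (16 * Δ)                      ≡⟨ merge-64 Π Δ ⟩
  32 * (2 * (Π * Δ))                      ∎)
  where
  open ℕ.≤-Reasoning
  Π Δ : ℕ
  Π = product (Vec.map (N ∸_) a)
  Δ = N ^ 2 ∸ normSq a
  15*N^2≤16*Δ : 15 * N ^ 2 ≤ 16 * Δ
  15*N^2≤16*Δ = 15*m≤16*[m∸n] {n = normSq a} (16*normSq≤m^2 a a≤P 4kP≤N)
  split-45 : ∀ x y → 45 * (x * y) ≡ (3 * x) * (15 * y)
  split-45 = ℕ.solve-∀
  merge-64 : ∀ x y → (4 * x) * (16 * y) ≡ 32 * (2 * (x * y))
  merge-64 = ℕ.solve-∀

-- Enumerating A

module Positional (b : ℕ) .{{_ : NonZero b}} where

  digits : ∀ k → ℕ → Vec ℕ k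
  digits zero    n = []
  digits (suc k) n = n % b ∷ digits k (n / b)

  fromDigits : ∀ {k} → Vec ℕ k → ℕ
  fromDigits []       = 0
  fromDigits (d ∷ ds) = d + fromDigits ds * b

  fromDigits-digits : ∀ k {n} → n < b ^ k → fromDigits (digits k n) ≡ n
  fromDigits-digits zero    {zero}  _          = refl
  fromDigits-digits zero    {suc n} (s≤s ())
  fromDigits-digits (suc k) {n}    n<b^[1+k] = begin
    n % b + fromDigits (digits k (n / b)) * b ≡⟨ cong (λ m → n % b + m * b) (fromDigits-digits k n/b<b^k) ⟩
    n % b + n / b * b                         ≡⟨ ℕ.m≡m%n+[m/n]*n n b ⟨
    n                                         ∎
    where
    open ≡-Reasoning
    n/b<b^k : n / b < b ^ k
    n/b<b^k = ℕ.m<n*o⇒m/o<n (subst (n <_) (ℕ.*-comm b (b ^ k)) n<b^[1+k])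

  digit<b : ∀ k n i → lookup (digits k n) i < b
  digit<b (suc k) n Fin.zero    = ℕ.m%n<n n b
  digit<b (suc k) n (Fin.suc i) = digit<b k (n / b) i

  fromDigits≢0⇒nonzeroDigit : ∀ {k} (ds : Vec ℕ k) → fromDigits ds ≢ 0 → ∃ λ i → lookup ds i ≢ 0
  fromDigits≢0⇒nonzeroDigit []            ≢0 = ⊥-elim (≢0 refl)
  fromDigits≢0⇒nonzeroDigit (suc d ∷ ds) _  = Fin.zero , λ ()
  fromDigits≢0⇒nonzeroDigit (zero  ∷ ds) ≢0 with fromDigits≢0⇒nonzeroDigit ds (λ ≡0 → ≢0 (cong (_* b) ≡0))
  ... | i , dᵢ≢0 = Fin.suc i , dᵢ≢0

enumA : ∀ P k → Fin (sizeA P k) → Vec ℕ k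
enumA P k i = digits k (suc (toℕ i))
  where open Positional (suc P)

module _ {P k : ℕ} where
  open Positional (suc P)

  private
    1+i<[1+P]^k : ∀ (i : Fin (sizeA P k)) → suc (toℕ i) < suc P ^ k
    1+i<[1+P]^k i = subst (_≤ suc P ^ k) (ℕ.+-comm (suc (toℕ i)) 1)
      (ℕ.m≤o∸n⇒m+n≤o (suc (toℕ i)) (ℕ.m^n>0 (suc P) k) (Fin.toℕ<n i))

  enumA-InA : ∀ i → InA P k (enumA P k i)
  enumA-InA i =
    (λ j → ℕ.s≤s⁻¹ (digit<b k (suc (toℕ i)) j)) ,
    fromDigits≢0⇒nonzeroDigit (enumA P k i)
      (λ ≡0 → ℕ.1+n≢0 (trans (sym (fromDigits-digits k (1+i<[1+P]^k i))) ≡0))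

  enumA-injective : ∀ i j → enumA P k i ≡ enumA P k j → i ≡ j
  enumA-injective i j eq = Fin.toℕ-injective (ℕ.suc-injective (begin
    suc (toℕ i)                         ≡⟨ fromDigits-digits k (1+i<[1+P]^k i) ⟨
    fromDigits (enumA P k i)            ≡⟨ cong fromDigits eq ⟩
    fromDigits (enumA P k j)            ≡⟨ fromDigits-digits k (1+i<[1+P]^k j) ⟩
    suc (toℕ j)                         ∎))
    where open ≡-Reasoning

construction-isPMRS : ∀ {ε} → ℚ.0ℚ ℚ.≤ ε → ε ℚ.≤ ℚ.½ → ∀ {N k P} → 4 * k * P ≤ N →
  IsPMRS (EdgeU N k P) (N ^ (k + 2)) (sizeA P k) ε
construction-isPMRS 0≤ε ε≤½ {N} {k} {P} 4kP≤N =
  M ,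
  (λ i → Ma-isMatching {a = a i} (a∈A i)) ,
  (λ i j i≢j (l , r) e∈Mi e∈Mj →
    i≢j (enumA-injective i j (InMa-determines-shift {l = l} {r} (∈-Ma⁻ (a i) e∈Mi) (∈-Ma⁻ (a j) e∈Mj)))) ,
  (λ i → ε*ℕ→ℚ≤ℕ→ℚ 0≤ε ε≤½ (N ^ (k + 2)) (length (M i)) (Ma-large {k} {N} {P} (a i) (proj₁ (a∈A i)) 4kP≤N)) ,
  (λ i → Ma-isPositive P (a i))
  where
  a : Fin (sizeA P k) → Vec ℕ k
  a = enumA P k
  a∈A : ∀ i → InA P k (a i)
  a∈A = enumA-InA {P} {k}
  M : Fin (sizeA P k) → List (Vtx N k × Vtx N k)
  M i = Ma N (a i)

theorem3p9 : (ε : ℚ) → ℚ.0ℚ ℚ.< ε → ε ℚ.< ℚ.½ → (k : ℕ) → 2 ℕ.≤ k →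
    Σ ℚ λ α → ℚ.0ℚ ℚ.< α × Σ ℚ λ c → ℚ.0ℚ ℚ.< c × Σ ℕ λ N₀ →
      ∀ N → N₀ ℕ.≤ N →
        (1 ℕ.≤ floorαN α N) ×
        IsPMRS (EdgeU N k (floorαN α N)) (N ^ (k + 2)) (sizeA (floorαN α N) k) ε ×
        (c ℚ.* ℕ→ℚ (N ^ k) ℚ.≤ ℕ→ℚ (sizeA (floorαN α N) k))
theorem3p9 ε 0<ε ε<½ k@(suc _) _ = 1/[1+ m′ ] , 0<1/[1+ m′ ] , c , 0<1/[1+ (2 * m) ^ k ] , m , large-N
  where
  m′ m : ℕ
  m′ = ℕ.pred (4 * k)
  -- k is a successor, so m reduces to 4 * k.
  m  = suc m′
  c : ℚ
  c  = 1/[1+ (2 * m) ^ k ]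
  Conclusion : ℕ → ℕ → Set
  Conclusion N P = (1 ≤ P) × IsPMRS (EdgeU N k P) (N ^ (k + 2)) (sizeA P k) ε ×
                   (c ℚ.* ℕ→ℚ (N ^ k) ℚ.≤ ℕ→ℚ (sizeA P k))
  large-N : ∀ N → m ≤ N → Conclusion N (floorαN 1/[1+ m′ ] N)
  large-N N m≤N = subst (Conclusion N) (sym (floorαN-1/[1+d] m′ N))
    ( ℕ.m≥n⇒m/n>0 m≤N
    , construction-isPMRS (ℚ.<⇒≤ 0<ε) (ℚ.<⇒≤ ε<½) (subst (_≤ N) (ℕ.*-comm (N / m) m) (ℕ.m/n*n≤m N m))
    , 1/[1+d]*ℕ→ℚ≤ℕ→ℚ ((2 * m) ^ k) (N ^ k) (sizeA (N / m) k)
        (N^k≤sizeA*[1+m^k] N (2 * m) (N / m) k (n≤2*m*[n/m] N m m≤N))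
    )
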